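{- Let $G$ be a finite simple graph with vertex set $[n]$ and with no 3-cycles, with edges ordered lexicographically. Then every tight spanning forest of $G$ with $k$ edges is an NBC set, i.e., $\mathcal{TF}_k(G)\subseteq\mathcal{NBC}_k(G)$ for all $k$.
   Context: Two sequences of distinct integers are order-isomorphic if their entries are in the same relative order; a sequence contains a pattern $\pi$ if some subsequence is order-isomorphic to $\pi$, and avoids it otherwise. A sequence of distinct integers is tight if it avoids $231$, $312$ and $321$. A labeled forest, with each component rooted at its smallest vertex, is tight if every path starting at a root has a tight label sequence. $\mathcal{TF}_k(G)$ is the set of edge sets of $G$ with $k$ edges forming tight forests. Edges $ij$ ($i<j$) are ordered lexicographically; a broken circuit is a cycle's edge set minus its smallest edge; an NBC set contains no broken circuit; $\mathcal{NBC}_k(G)$ is the set of NBC sets with $k$ edges. -}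

module Defs where

open import Data.Nat using (ℕ; _<_; _≤_)
open import Data.Fin using (Fin; toℕ)
import Data.Fin as F
open import Data.Product using (_×_; _,_; Σ; ∃; ∃-syntax)
open import Data.Sum using (_⊎_)
open import Data.List using (List; []; _∷_; _++_; [_]; length; map; lookup)
open import Data.List.Membership.Propositional using (_∈_)
open import Data.List.Relation.Unary.All using (All)
open import Data.List.Relation.Unary.Unique.Propositional using (Unique)
open import Data.List.Relation.Unary.Linked using (Linked)
open import Relation.Binary.Construct.Closure.ReflexiveTransitive using (Star)
open import Relation.Binary.PropositionalEquality using (_≡_)
open import Relation.Nullary using (¬_; yes; no)

Contains : List ℕ → List ℕ → Set
Contains π xs =
  Σ (Fin (length π) → Fin (length xs)) λ f →
    (∀ p q → p F.< q → f p F.< f q) ×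
    (∀ p q → (lookup π p < lookup π q → lookup xs (f p) < lookup xs (f q))
           × (lookup xs (f p) < lookup xs (f q) → lookup π p < lookup π q))

Avoids : List ℕ → List ℕ → Set
Avoids π xs = ¬ Contains π xs

Tight : List ℕ → Set
Tight xs = Avoids (2 ∷ 3 ∷ 1 ∷ []) xs
         × Avoids (3 ∷ 1 ∷ 2 ∷ []) xs
         × Avoids (3 ∷ 2 ∷ 1 ∷ []) xs

-- Graphs on the vertex set Fin n (vertex i has label toℕ i; this is an
-- order-preserving relabelling of [n]).  An edge ij with i<j is stored
-- as the pair (i , j).

Edge : ℕ → Set
Edge n = Fin n × Fin n

WellFormed : ∀ {n} → List (Edge n) → Set
WellFormed E = All (λ e → Data.Product.proj₁ e F.< Data.Product.proj₂ e) E × Unique E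
  where import Data.Product

record Graph (n : ℕ) : Set where
  field
    edges : List (Edge n)
    wf    : WellFormed edges
open Graph public

Adj : ∀ {n} → List (Edge n) → Fin n → Fin n → Set
Adj E u v = (u , v) ∈ E ⊎ (v , u) ∈ E

norm : ∀ {n} → Fin n → Fin n → Edge n
norm u v with toℕ u Data.Nat.<? toℕ v
  where import Data.Nat
... | yes _ = (u , v)
... | no  _ = (v , u)

steps : ∀ {A : Set} → List A → List (A × A)
steps []           = []
steps (x ∷ [])     = []
steps (x ∷ y ∷ xs) = (x , y) ∷ steps (y ∷ xs)

record Cycle {n} (E : List (Edge n)) : Set where
  field
    start : Fin n
    rest  : List (Fin n)
    long  : 3 ≤ length (start ∷ rest)
    dist  : Unique (start ∷ rest)
    linked : Linked (Adj E) (start ∷ rest ++ [ start ])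
open Cycle public

cycleEdges : ∀ {n} {E : List (Edge n)} → Cycle E → List (Edge n)
cycleEdges c = map (λ p → norm (Data.Product.proj₁ p) (Data.Product.proj₂ p))
                   (steps (start c ∷ rest c ++ [ start c ]))
  where import Data.Product

_<lex_ : ∀ {n} → Edge n → Edge n → Set
(i , j) <lex (i' , j') = (toℕ i < toℕ i') ⊎ ((toℕ i ≡ toℕ i') × (toℕ j < toℕ j'))

_⊆E_ : ∀ {n} → List (Edge n) → List (Edge n) → Set
S ⊆E E = All (_∈ E) S

NoTriangle : ∀ {n} → Graph n → Set
NoTriangle G = ∀ a b c → ¬ (Adj (edges G) a b × Adj (edges G) b c × Adj (edges G) a c)

-- broken circuit of the cycle c (its edges minus the lex-smallest one)
-- is contained in S: every edge of c that is not the smallest lies in S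
BrokenCircuitIn : ∀ {n} {E : List (Edge n)} → Cycle E → List (Edge n) → Set
BrokenCircuitIn c S = ∀ e → e ∈ cycleEdges c → (∃[ e' ] (e' ∈ cycleEdges c × e' <lex e)) → e ∈ S

NBC : ∀ {n} → ℕ → Graph n → List (Edge n) → Set
NBC k G S = WellFormed S × S ⊆E edges G × length S ≡ k
          × ∀ (c : Cycle (edges G)) → ¬ BrokenCircuitIn c S

Forest : ∀ {n} → Graph n → List (Edge n) → Set
Forest G S = WellFormed S × S ⊆E edges G × ¬ Cycle S

IsRoot : ∀ {n} → List (Edge n) → Fin n → Set
IsRoot S r = ∀ w → Star (Adj S) r w → toℕ r ≤ toℕ w

IsPath : ∀ {n} → List (Edge n) → List (Fin n) → Set
IsPath S vs = Unique vs × Linked (Adj S) vs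

TightForest : ∀ {n} → ℕ → Graph n → List (Edge n) → Set
TightForest k G S = Forest G S × length S ≡ k
  × ∀ r vs → IsRoot S r → IsPath S (r ∷ vs) → Tight (map toℕ (r ∷ vs))

-- Suppose the tight forest S contained the broken circuit of a cycle C of G.  List C from its
-- least vertex a, with neighbours c and b on C, b < c.  Then (a , b) is the least edge of C, so
-- the path a c … b around C lies in S, and since G has no triangle this path has at least four
-- vertices.  The root of the component of a reaches the path by a simple path of S meeting it
-- first at some vertex p.  Continuing from p along C gives a root path of S containing distinct
-- entries x … y … z with z < x (from c to b if p is a or c, from p back to a otherwise), and every
-- such triple is an occurrence of 231, 312 or 321.
module Submission where

open import Defs
open import Function using (_∘_)
open import Level using (0ℓ)
open import Data.Empty using (⊥; ⊥-elim)
open import Data.Nat using (ℕ; _<_; _≤_; z<s; s<s; s≤s⁻¹; _<?_)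
open import Data.Nat.Properties using (<-asym; <-irrefl; <-cmp; <-trans; ≰⇒>; 1+n≰n; ≤-totalOrder)
open import Data.Fin using (Fin; toℕ)
import Data.Fin as F
import Data.Fin.Properties as F
open import Data.Fin.Induction using (<-wellFounded)
open import Data.Product using (_×_; _,_; proj₁; proj₂; swap; map₁; uncurry; ∃-syntax; ∃₂)
import Data.Product as Prod
open import Data.Sum using (inj₁; inj₂; [_,_]′)
import Data.Sum as Sum
open import Data.List using (List; []; _∷_; _++_; [_]; _∷ʳ_; length; lookup; map; take; reverse; reverseAcc; initLast; _∷ʳ′_)
open import Data.List.Properties using (++-assoc; ++-identityʳ; map-++; reverse-++; unfold-reverse)
open import Data.List.Extrema ≤-totalOrder using (argmin; f[argmin]≤f[⊤]; f[argmin]≤f[xs]; argmin-sel)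
open import Data.List.Membership.Propositional using (_∈_; _∉_)
open import Data.List.Membership.Propositional.Properties using (∈-∃++; ∈-map⁺; ∈-map⁻; ∈-++⁺ˡ; ∈-++⁺ʳ)
open import Data.List.Relation.Unary.Any using (here; there; index)
open import Data.List.Relation.Unary.Any.Properties using (lookup-index; reverse⁻)
open import Data.List.Relation.Unary.All using (All; []; _∷_)
import Data.List.Relation.Unary.All as All
import Data.List.Relation.Unary.All.Properties as All
open import Data.List.Relation.Unary.Linked using (Linked; []; [-]; _∷_)
import Data.List.Relation.Unary.Linked as Linked
open import Data.List.Relation.Unary.Unique.Propositional using (Unique; []; _∷_)
import Data.List.Relation.Unary.Unique.Propositional.Properties as Unique
open import Data.List.Relation.Binary.Subset.Propositional using (_⊆_)
open import Data.List.Relation.Binary.Permutation.Propositional using (_↭_; prep; ↭-sym; ↭⇒↭ₛ)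
open import Data.List.Relation.Binary.Permutation.Propositional.Properties
  using (↭-reverse; ++-comm; All-resp-↭; ↭-length)
import Data.List.Relation.Binary.Permutation.Setoid.Properties as Permutationₛ
open import Relation.Binary.Core using (Rel)
open import Relation.Binary.Definitions using (Symmetric; tri<; tri≈; tri>)
open import Relation.Binary.Construct.Closure.ReflexiveTransitive using (Star; ε; _◅_; _◅◅_)
import Relation.Binary.Construct.Closure.ReflexiveTransitive as Star
open import Relation.Binary.PropositionalEquality using (_≡_; _≢_; refl; sym; trans; cong; subst; setoid)
open import Relation.Nullary using (¬_; yes; no)
open import Relation.Nullary.Negation using (¬¬-map)
import Induction.WellFounded as WF

Contains-∷ : ∀ {π ys} y → Contains π ys → Contains π (y ∷ ys)
Contains-∷ _ (f , mono , iso) = F.suc ∘ f , (λ p q p<q → s<s (mono p q p<q)) , iso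

Contains-++ : ∀ {π ys} xs → Contains π ys → Contains π (xs ++ ys)
Contains-++     []       c = c
Contains-++ {π} (x ∷ xs) c = Contains-∷ {π} x (Contains-++ {π} xs c)

Tight-++⁻ʳ : ∀ {ys} xs → Tight (xs ++ ys) → Tight ys
Tight-++⁻ʳ xs (¬231 , ¬312 , ¬321) =
  ¬231 ∘ Contains-++ {2 ∷ 3 ∷ 1 ∷ []} xs ,
  ¬312 ∘ Contains-++ {3 ∷ 1 ∷ 2 ∷ []} xs ,
  ¬321 ∘ Contains-++ {3 ∷ 2 ∷ 1 ∷ []} xs

Agree : ℕ → ℕ → ℕ → ℕ → Set
Agree x y x′ y′ = (x < y → x′ < y′) × (x′ < y′ → x < y)

SameOrder : ℕ → ℕ → ℕ → ℕ → Set
SameOrder x y x′ y′ = Agree x y x′ y′ × Agree y x y′ x′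

Agree-refl : ∀ {x x′} → Agree x x x′ x′
Agree-refl = (λ x<x → ⊥-elim (<-irrefl refl x<x)) , (λ x′<x′ → ⊥-elim (<-irrefl refl x′<x′))

SameOrder-< : ∀ {x y x′ y′} → x < y → x′ < y′ → SameOrder x y x′ y′
SameOrder-< x<y x′<y′ =
  ((λ _ → x′<y′) , (λ _ → x<y)) ,
  ((λ y<x → ⊥-elim (<-asym x<y y<x)) , (λ y′<x′ → ⊥-elim (<-asym x′<y′ y′<x′)))

SameOrder-> : ∀ {x y x′ y′} → y < x → y′ < x′ → SameOrder x y x′ y′
SameOrder-> y<x y′<x′ = swap (SameOrder-< y<x y′<x′)

Contains-triple : ∀ {α β γ u v w} zs → w ∈ zs →
                  SameOrder α β u v → SameOrder α γ u w → SameOrder β γ v w →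
                  Contains (α ∷ β ∷ γ ∷ []) (u ∷ v ∷ zs)
Contains-triple {α} {β} {γ} {u} {v} {w} zs w∈ αβ αγ βγ = f , mono , iso
  where
  π xs : List ℕ
  π  = α ∷ β ∷ γ ∷ []
  xs = u ∷ v ∷ zs

  w≡ : w ≡ lookup zs (index w∈)
  w≡ = lookup-index w∈

  αγ′ : SameOrder α γ u (lookup zs (index w∈))
  αγ′ = subst (SameOrder α γ u) w≡ αγ

  βγ′ : SameOrder β γ v (lookup zs (index w∈))
  βγ′ = subst (SameOrder β γ v) w≡ βγ

  f : Fin 3 → Fin (length xs)
  f F.zero            = F.zero
  f (F.suc F.zero)    = F.suc F.zero
  f (F.suc (F.suc _)) = F.suc (F.suc (index w∈))

  mono : ∀ p q → p F.< q → f p F.< f q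
  mono F.zero                 (F.suc F.zero)         _              = z<s
  mono F.zero                 (F.suc (F.suc F.zero)) _              = z<s
  mono (F.suc F.zero)         (F.suc (F.suc F.zero)) _              = s<s z<s
  mono (F.suc F.zero)         (F.suc F.zero)         (s<s ())
  mono (F.suc (F.suc F.zero)) (F.suc F.zero)         (s<s ())
  mono (F.suc (F.suc F.zero)) (F.suc (F.suc F.zero)) (s<s (s<s ()))

  iso : ∀ p q → Agree (lookup π p) (lookup π q) (lookup xs (f p)) (lookup xs (f q))
  iso F.zero                 F.zero                 = Agree-refl
  iso F.zero                 (F.suc F.zero)         = proj₁ αβ
  iso F.zero                 (F.suc (F.suc F.zero)) = proj₁ αγ′
  iso (F.suc F.zero)         F.zero                 = proj₂ αβ
  iso (F.suc F.zero)         (F.suc F.zero)         = Agree-refl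
  iso (F.suc F.zero)         (F.suc (F.suc F.zero)) = proj₁ βγ′
  iso (F.suc (F.suc F.zero)) F.zero                 = proj₂ αγ′
  iso (F.suc (F.suc F.zero)) (F.suc F.zero)         = proj₂ βγ′
  iso (F.suc (F.suc F.zero)) (F.suc (F.suc F.zero)) = Agree-refl

¬Tight-descent : ∀ {u v w} zs → w ∈ zs → w < u → u ≢ v → v ≢ w → ¬ Tight (u ∷ v ∷ zs)
¬Tight-descent zs w∈ w<u u≢v v≢w (¬231 , ¬312 , ¬321) with <-cmp _ _ | <-cmp _ _
... | tri< u<v _ _ | _ = ¬231 (Contains-triple zs w∈
        (SameOrder-< (s<s (s<s z<s)) u<v) (SameOrder-> (s<s z<s) w<u) (SameOrder-> (s<s z<s) (<-trans w<u u<v)))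
... | tri≈ _ u≡v _ | _ = u≢v u≡v
... | tri> _ _ v<u | tri< v<w _ _ = ¬312 (Contains-triple zs w∈
        (SameOrder-> (s<s z<s) v<u) (SameOrder-> (s<s (s<s z<s)) w<u) (SameOrder-< (s<s z<s) v<w))
... | tri> _ _ _   | tri≈ _ v≡w _ = v≢w v≡w
... | tri> _ _ v<u | tri> _ _ w<v = ¬321 (Contains-triple zs w∈
        (SameOrder-> (s<s (s<s z<s)) v<u) (SameOrder-> (s<s z<s) w<u) (SameOrder-> (s<s z<s) w<v))

¬Tight-toℕ-descent : ∀ {n} {u v w : Fin n} {zs} → Unique (u ∷ v ∷ zs) → w ∈ zs → w F.< u →
                     ¬ Tight (map toℕ (u ∷ v ∷ zs))
¬Tight-toℕ-descent {zs = zs} ((u≢v ∷ _) ∷ v∉zs ∷ _) w∈ w<u =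
  ¬Tight-descent (map toℕ zs) (∈-map⁺ toℕ w∈) w<u
    (u≢v ∘ F.toℕ-injective) (All.lookup v∉zs w∈ ∘ F.toℕ-injective)

module _ {A : Set} where

  Unique-resp-↭ : ∀ {xs ys : List A} → xs ↭ ys → Unique xs → Unique ys
  Unique-resp-↭ p = Permutationₛ.Unique-resp-↭ (setoid A) (↭⇒↭ₛ p)

  Unique-++⁻ˡ : ∀ xs {ys : List A} → Unique (xs ++ ys) → Unique xs
  Unique-++⁻ˡ []       _          = []
  Unique-++⁻ˡ (x ∷ xs) (x∉ ∷ xs!) = All.++⁻ˡ xs x∉ ∷ Unique-++⁻ˡ xs xs!

  Unique-++⁻ʳ : ∀ xs {ys : List A} → Unique (xs ++ ys) → Unique ys
  Unique-++⁻ʳ []       xs!       = xs!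
  Unique-++⁻ʳ (x ∷ xs) (_ ∷ xs!) = Unique-++⁻ʳ xs xs!

  reverse-∷ : ∀ (x : A) xs → ∃₂ λ y ys → reverse (x ∷ xs) ≡ y ∷ ys
  reverse-∷ x xs with reverse xs | unfold-reverse x xs
  ... | []     | eq = x , [] , eq
  ... | y ∷ ys | eq = y , ys ∷ʳ x , eq

  Linked-steps : ∀ (xs : List A) → Linked (λ x y → (x , y) ∈ steps xs) xs
  Linked-steps []           = []
  Linked-steps (x ∷ [])     = [-]
  Linked-steps (x ∷ y ∷ xs) = here refl ∷ Linked.map there (Linked-steps (y ∷ xs))

Cyclic : ∀ {A : Set} → Rel A 0ℓ → List A → Set
Cyclic R xs = Linked R (xs ++ take 1 xs)

module _ {A : Set} {R : Rel A 0ℓ} where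

  Linked-split : ∀ xs {y ys} → Linked R (xs ++ y ∷ ys) → Linked R (xs ++ [ y ]) × Linked R (y ∷ ys)
  Linked-split []            l       = [-] , l
  Linked-split (x ∷ [])      (r ∷ l) = r ∷ [-] , l
  Linked-split (x ∷ x′ ∷ xs) (r ∷ l) = map₁ (r ∷_) (Linked-split (x′ ∷ xs) l)

  Linked-join : ∀ xs {y ys} → Linked R (xs ++ [ y ]) → Linked R (y ∷ ys) → Linked R (xs ++ y ∷ ys)
  Linked-join []            _       l′ = l′
  Linked-join (x ∷ [])      (r ∷ _) l′ = r ∷ l′
  Linked-join (x ∷ x′ ∷ xs) (r ∷ l) l′ = r ∷ Linked-join (x′ ∷ xs) l l′

  Linked-fromAll : ∀ {P : A → Set} → (∀ {x y} → P x → P y → R x y) → ∀ {xs} → All P xs → Linked R xs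
  Linked-fromAll f []              = []
  Linked-fromAll f (px ∷ [])       = [-]
  Linked-fromAll f (px ∷ py ∷ pxs) = f px py ∷ Linked-fromAll f (py ∷ pxs)

  module _ (R-sym : Symmetric R) where

    Linked-reverseAcc : ∀ {x} acc xs → Linked R (x ∷ acc) → Linked R (x ∷ xs) →
                        Linked R (reverseAcc (x ∷ acc) xs)
    Linked-reverseAcc acc []       l-acc _         = l-acc
    Linked-reverseAcc acc (y ∷ ys) l-acc (r ∷ l-ys) = Linked-reverseAcc (_ ∷ acc) ys (R-sym r ∷ l-acc) l-ys

    Linked-reverse : ∀ {xs} → Linked R xs → Linked R (reverse xs)
    Linked-reverse {[]}     _ = []
    Linked-reverse {x ∷ xs} l = Linked-reverseAcc [] xs [-] l

  Cyclic-rotate : ∀ xs ys → Cyclic R (xs ++ ys) → Cyclic R (ys ++ xs)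
  Cyclic-rotate []       ys       c = subst (Cyclic R) (sym (++-identityʳ ys)) c
  Cyclic-rotate (x ∷ xs) []       c = subst (Cyclic R) (++-identityʳ (x ∷ xs)) c
  Cyclic-rotate (x ∷ xs) (y ∷ ys) c =
    subst (λ zs → Linked R (y ∷ zs)) (sym (++-assoc ys (x ∷ xs) [ y ])) (Linked-join (y ∷ ys) y⋯x x⋯y)
    where
    halves : Linked R (x ∷ xs ++ [ y ]) × Linked R (y ∷ ys ++ [ x ])
    halves = Linked-split (x ∷ xs) (subst (λ zs → Linked R (x ∷ zs)) (++-assoc xs (y ∷ ys) [ x ]) c)
    x⋯y : Linked R (x ∷ xs ++ [ y ])
    x⋯y = proj₁ halves
    y⋯x : Linked R (y ∷ ys ++ [ x ])
    y⋯x = proj₂ halves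

  Cyclic-open : ∀ {x} xs {y} → Cyclic R (x ∷ xs ++ [ y ]) → Linked R (x ∷ xs ++ [ y ]) × R y x
  Cyclic-open {x} xs {y} c with Linked-split (x ∷ xs) (subst (λ zs → Linked R (x ∷ zs)) (++-assoc xs [ y ] [ x ]) c)
  ... | l , (r ∷ [-]) = l , r

  Cyclic-reverse : Symmetric R → ∀ {x} xs → Cyclic R (x ∷ xs) → Cyclic R (x ∷ reverse xs)
  Cyclic-reverse R-sym {x} xs c = subst (Linked R) reverse-closed (Linked-reverse R-sym c)
    where
    reverse-closed : reverse (x ∷ xs ++ [ x ]) ≡ x ∷ reverse xs ++ [ x ]
    reverse-closed = trans (unfold-reverse x (xs ++ [ x ])) (cong (_++ [ x ]) (reverse-++ xs [ x ]))

Adj-sym : ∀ {n} {E : List (Edge n)} → Symmetric (Adj E)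
Adj-sym = Sum.swap

RootPathsTight : ∀ {n} → List (Edge n) → Set
RootPathsTight S = ∀ r vs → IsRoot S r → IsPath S (r ∷ vs) → Tight (map toℕ (r ∷ vs))

module _ {n} {S : List (Edge n)} where

  IsPath-tail : ∀ {x xs} → IsPath S (x ∷ xs) → IsPath S xs
  IsPath-tail (_ ∷ xs! , l) = xs! , Linked.tail l

  IsPath-reverse : ∀ {xs} → IsPath S xs → IsPath S (reverse xs)
  IsPath-reverse (xs! , l) = Unique-resp-↭ (↭-sym (↭-reverse _)) xs! , Linked-reverse Adj-sym l

module _ {n} (S : List (Edge n)) where

  open import Data.List.Membership.DecPropositional (F._≟_ {n}) using (_∈?_)

  Rooted : Fin n → Set
  Rooted v = ∃[ r ] IsRoot S r × Star (Adj S) r v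

  -- IsRoot is not decidable, so the least vertex of a component is only found under ¬¬.
  ¬¬rooted : ∀ v → ¬ ¬ Rooted v
  ¬¬rooted = WF.All.wfRec <-wellFounded 0ℓ (λ v → ¬ ¬ Rooted v) descend
    where
    descend : ∀ v → (∀ {w} → w F.< v → ¬ ¬ Rooted w) → ¬ ¬ Rooted v
    descend v below ¬rooted = ¬rooted (v , v-isRoot , ε)
      where
      v-isRoot : IsRoot S v
      v-isRoot w v⇝w with v F.≤? w
      ... | yes v≤w = v≤w
      ... | no  v≰w = ⊥-elim (below (≰⇒> v≰w) λ (r , r-isRoot , r⇝w) →
                        ¬rooted (r , r-isRoot , r⇝w ◅◅ Star.reverse Adj-sym v⇝w))

  -- A simple path from r whose last vertex is its only vertex in P.
  data Entry (P : List (Fin n)) (r : Fin n) : Set where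
    inside  : r ∈ P → Entry P r
    outside : ∀ pre {p} → p ∈ P → All (_∉ P) (r ∷ pre) → Unique (r ∷ pre) →
              Linked (Adj S) (r ∷ pre ++ [ p ]) → Entry P r

  Entry-extend : ∀ {P r r′} → Adj S r r′ → r ∉ P → Entry P r′ → Entry P r
  Entry-extend r~r′ r∉P (inside r′∈P) = outside [] r′∈P (r∉P ∷ []) ([] ∷ []) (r~r′ ∷ [-])
  Entry-extend {P} {r} {r′} r~r′ r∉P (outside pre {p} p∈P out pre! l) with r ∈? r′ ∷ pre
  ... | no  r∉pre = outside (r′ ∷ pre) p∈P (r∉P ∷ out) (All.¬Any⇒All¬ _ r∉pre ∷ pre!) (r~r′ ∷ l)
  ... | yes r∈pre with ∈-∃++ r∈pre
  ...   | A , B , r′∷pre≡ =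
    outside B p∈P (All.++⁻ʳ A (subst (All (_∉ P)) r′∷pre≡ out))
      (Unique-++⁻ʳ A (subst Unique r′∷pre≡ pre!))
      (proj₂ (Linked-split A (subst (Linked (Adj S)) (++-assoc A (r ∷ B) [ p ])
        (subst (λ zs → Linked (Adj S) (zs ++ [ p ])) r′∷pre≡ l))))

  -- loop erasure of the walk, cut at its first visit to P
  entry : ∀ {P r a} → Star (Adj S) r a → a ∈ P → Entry P r
  entry ε a∈P = inside a∈P
  entry {P} {r} (r~r′ ◅ walk) a∈P with r ∈? P
  ... | yes r∈P = inside r∈P
  ... | no  r∉P = Entry-extend r~r′ r∉P (entry walk a∈P)

  TightFrom : List (Fin n) → Fin n → Set
  TightFrom P p = ∀ rest → rest ⊆ P → IsPath S (p ∷ rest) → Tight (map toℕ (p ∷ rest))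

  Entry-tight : RootPathsTight S → ∀ {P r} → IsRoot S r → Entry P r → ∃[ p ] p ∈ P × TightFrom P p
  Entry-tight tight r-isRoot (inside r∈P) = _ , r∈P , λ rest _ → tight _ rest r-isRoot
  Entry-tight tight {P} {r} r-isRoot (outside pre {p} p∈P out pre! l) = p , p∈P , tight-from-p
    where
    tight-from-p : TightFrom P p
    tight-from-p rest rest⊆P (p∷rest! , l′) =
      Tight-++⁻ʳ (map toℕ (r ∷ pre)) (subst Tight (map-++ toℕ (r ∷ pre) (p ∷ rest))
        (tight r (pre ++ p ∷ rest) r-isRoot (Unique.++⁺ pre! p∷rest! disjoint , Linked-join (r ∷ pre) l l′)))
      where
      disjoint : ∀ {x} → ¬ (x ∈ r ∷ pre × x ∈ p ∷ rest)
      disjoint (x∈pre , here refl) = All.lookup out x∈pre p∈P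
      disjoint (x∈pre , there x∈rest) = All.lookup out x∈pre (rest⊆P x∈rest)

  ¬¬tightEntry : RootPathsTight S → ∀ {P a} → a ∈ P → ¬ ¬ (∃[ p ] p ∈ P × TightFrom P p)
  ¬¬tightEntry tight {a = a} a∈P =
    ¬¬-map (λ (r , r-isRoot , walk) → Entry-tight tight r-isRoot (entry walk a∈P)) (¬¬rooted a)

  -- The root path meets P first at some p.  If p is a or c it continues along P to b < c;
  -- otherwise it turns back along P down to a < p.
  noDescendingPath : RootPathsTight S → ∀ {a c q b} T → IsPath S (a ∷ c ∷ q ∷ T) →
                     All (a F.<_) (c ∷ q ∷ T) → b ∈ T → b F.< c → ⊥
  noDescendingPath tight {a} {c} {q} {b} T path above b∈T b<c = ¬¬tightEntry tight (here refl) entered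
    where
    P : List (Fin n)
    P = a ∷ c ∷ q ∷ T

    forward : ¬ Tight (map toℕ (c ∷ q ∷ T))
    forward = ¬Tight-toℕ-descent (proj₁ (IsPath-tail path)) b∈T b<c

    backward : ∀ {p} → p ∈ q ∷ T → ¬ TightFrom P p
    backward {p} p∈ tight-from-p with ∈-∃++ p∈
    ... | X , Y , q∷T≡ with reverse-∷ c X
    ...   | v , zs , reverse-c∷X≡ =
      ¬Tight-toℕ-descent (proj₁ back-path) (∈-++⁺ʳ zs (here refl)) (All.lookup above (there p∈))
        (tight-from-p (v ∷ zs ++ [ a ]) back⊆P back-path)
      where
      L : List (Fin n)
      L = a ∷ c ∷ X
      path′ : IsPath S (L ++ p ∷ Y)
      path′ = subst (λ xs → IsPath S (a ∷ c ∷ xs)) q∷T≡ path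
      to-p : IsPath S (L ++ [ p ])
      to-p = Unique-++⁻ˡ (L ++ [ p ]) (subst Unique (sym (++-assoc L [ p ] Y)) (proj₁ path′)) ,
             proj₁ (Linked-split L (proj₂ path′))
      reverse-L≡ : reverse L ≡ v ∷ zs ++ [ a ]
      reverse-L≡ = trans (unfold-reverse a (c ∷ X)) (cong (_∷ʳ a) reverse-c∷X≡)
      back-path : IsPath S (p ∷ v ∷ zs ++ [ a ])
      back-path = subst (IsPath S) (trans (reverse-++ L [ p ]) (cong (p ∷_) reverse-L≡)) (IsPath-reverse to-p)
      back⊆P : v ∷ zs ++ [ a ] ⊆ P
      back⊆P {x} x∈ = subst (λ xs → x ∈ a ∷ c ∷ xs) (sym q∷T≡)
                        (∈-++⁺ˡ {xs = L} (reverse⁻ (subst (x ∈_) (sym reverse-L≡) x∈)))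

    entered : ¬ (∃[ p ] p ∈ P × TightFrom P p)
    entered (_ , here refl , tight-from-a) =
      forward (Tight-++⁻ʳ [ toℕ a ] (tight-from-a (c ∷ q ∷ T) there path))
    entered (_ , there (here refl) , tight-from-c) =
      forward (tight-from-c (q ∷ T) (there ∘ there) (IsPath-tail path))
    entered (_ , there (there p∈) , tight-from-p) = backward p∈ tight-from-p

norm-Adj : ∀ {n} {E : List (Edge n)} x y → norm x y ∈ E → Adj E x y
norm-Adj x y with toℕ x <? toℕ y
... | yes _ = inj₁
... | no  _ = inj₂

norm-ordered : ∀ {n} (x y : Fin n) → ¬ proj₂ (norm x y) F.< proj₁ (norm x y)
norm-ordered x y with toℕ x <? toℕ y
... | yes x<y = <-asym x<y
... | no  x≮y = x≮y

record CycleFromMin {n} (R : Rel (Fin n) 0ℓ) (a : Fin n) (xs : List (Fin n)) : Set where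
  constructor cycleFromMin
  field
    closed : Cyclic R (a ∷ xs)
    simple : Unique (a ∷ xs)
    above  : All (a F.<_) xs
open CycleFromMin

argmin∈ : ∀ {n} (x : Fin n) xs → argmin toℕ x xs ∈ x ∷ xs
argmin∈ x xs = [ here , there ]′ (argmin-sel toℕ x xs)

argmin≤ : ∀ {n} (x : Fin n) xs → All (argmin toℕ x xs F.≤_) (x ∷ xs)
argmin≤ x xs = f[argmin]≤f[⊤] {f = toℕ} x xs ∷ f[argmin]≤f[xs] {f = toℕ} x xs

module _ {n} {R : Rel (Fin n) 0ℓ} where

  CycleFromMin-reverse : Symmetric R → ∀ {a xs} → CycleFromMin R a xs → CycleFromMin R a (reverse xs)
  CycleFromMin-reverse R-sym {a} {xs} (cycleFromMin closed simple above) =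
    cycleFromMin (Cyclic-reverse R-sym xs closed)
             (Unique-resp-↭ (prep a (↭-sym (↭-reverse xs))) simple)
             (All-resp-↭ (↭-sym (↭-reverse xs)) above)

  CycleFromMin-rotate : ∀ x xs → Cyclic R (x ∷ xs) → Unique (x ∷ xs) →
                    ∃₂ λ a ys → CycleFromMin R a ys × length (x ∷ xs) ≡ length (a ∷ ys)
  CycleFromMin-rotate x xs closed simple with ∈-∃++ (argmin∈ x xs)
  ... | A , B , x∷xs≡ = a , B ++ A , cycleFromMin rotated-closed rotated-simple rotated-above , ↭-length rotation
    where
    a : Fin n
    a = argmin toℕ x xs
    rotation : x ∷ xs ↭ a ∷ B ++ A
    rotation = subst (_↭ a ∷ B ++ A) (sym x∷xs≡) (++-comm A (a ∷ B))
    rotated-closed : Cyclic R (a ∷ B ++ A)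
    rotated-closed = Cyclic-rotate A (a ∷ B) (subst (Cyclic R) x∷xs≡ closed)
    rotated-simple : Unique (a ∷ B ++ A)
    rotated-simple = Unique-resp-↭ rotation simple
    rotated-above : All (a F.<_) (B ++ A)
    rotated-above with rotated-simple | All-resp-↭ rotation (argmin≤ x xs)
    ... | a∉ ∷ _ | _ ∷ a≤ = All.zipWith (uncurry F.≤∧≢⇒<) (a≤ , a∉)

module _ {n} (G : Graph n) (noTriangle : NoTriangle G) (S : List (Edge n)) (tight : RootPathsTight S)
         (c : Cycle (edges G)) (broken : BrokenCircuitIn c S) where

  private
    CE : List (Edge n)
    CE = cycleEdges c

  CycleStep : Fin n → Fin n → Set
  CycleStep x y = Adj (edges G) x y × Adj CE x y

  CycleStep-sym : Symmetric CycleStep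
  CycleStep-sym = Prod.map Adj-sym Adj-sym

  cycle-closed : Cyclic CycleStep (start c ∷ rest c)
  cycle-closed = Linked.zip (linked c , Linked.map (λ {x} {y} st → norm-Adj x y (∈-map⁺ _ st)) (Linked-steps _))

  CE-ordered : ∀ {x y} → (x , y) ∈ CE → ¬ y F.< x
  CE-ordered xy∈ with ∈-map⁻ _ xy∈
  ... | (u , v) , _ , xy≡ = subst (λ e → ¬ proj₂ e F.< proj₁ e) (sym xy≡) (norm-ordered u v)

  Adj-CE-oriented : ∀ {x y} → Adj CE x y → x F.< y → (x , y) ∈ CE
  Adj-CE-oriented (inj₁ xy∈) _   = xy∈
  Adj-CE-oriented (inj₂ yx∈) x<y = ⊥-elim (CE-ordered yx∈ x<y)

  Above : Edge n → Fin n → Fin n → Set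
  Above e x y = e <lex (x , y) × e <lex (y , x)

  Adj-CE⇒Adj-S : ∀ {e x y} → e ∈ CE → Adj CE x y → Above e x y → Adj S x y
  Adj-CE⇒Adj-S e∈ (inj₁ xy∈) (e<xy , _) = inj₁ (broken _ xy∈ (_ , e∈ , e<xy))
  Adj-CE⇒Adj-S e∈ (inj₂ yx∈) (_ , e<yx) = inj₂ (broken _ yx∈ (_ , e∈ , e<yx))

  -- The closing edge (a , b) is the least edge of the cycle, so the other edges lie in S.
  CycleFromMin-path : ∀ {a c b} ys → CycleFromMin CycleStep a (c ∷ ys ++ [ b ]) → b F.< c →
                  Linked (Adj S) (a ∷ c ∷ ys ++ [ b ])
  CycleFromMin-path {a} {c} {b} ys low b<c with Cyclic-open (c ∷ ys) (closed low)
  ... | walk , (_ , ba∈) =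
    Linked.zipWith (λ ((_ , xy∈) , above-ab) → Adj-CE⇒Adj-S ab∈ xy∈ above-ab) (walk , walk-above-ab)
    where
    ab∈ : (a , b) ∈ CE
    ab∈ = Adj-CE-oriented (Adj-sym ba∈) (All.lookup (above low) (∈-++⁺ʳ (c ∷ ys) (here refl)))
    walk-above-ab : Linked (Above (a , b)) (a ∷ c ∷ ys ++ [ b ])
    walk-above-ab = (inj₂ (refl , b<c) , inj₁ (All.head (above low))) ∷
                    Linked-fromAll (λ a<x a<y → inj₁ a<x , inj₁ a<y) (above low)

  CycleFromMin-descent : ∀ {a c b} ys → CycleFromMin CycleStep a (c ∷ ys ++ [ b ]) → b F.< c → ⊥
  CycleFromMin-descent {c = c} [] low _ with Cyclic-open [ c ] (closed low)
  ... | (ac ∷ cb ∷ [-]) , ba = noTriangle _ _ _ (proj₁ ac , proj₁ cb , Adj-sym (proj₁ ba))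
  CycleFromMin-descent {b = b} (q ∷ T) low b<c =
    noDescendingPath S tight (T ++ [ b ]) (simple low , CycleFromMin-path (q ∷ T) low b<c) (above low)
      (∈-++⁺ʳ T (here refl)) b<c

  CycleFromMin-impossible : ∀ {a xs} → CycleFromMin CycleStep a xs → 2 ≤ length xs → ⊥
  CycleFromMin-impossible {xs = []}     _   ()
  CycleFromMin-impossible {xs = c ∷ xs} low len with initLast xs
  ... | [] = 1+n≰n len
  ... | ys ∷ʳ′ b with F.<-cmp b c
  ...   | tri< b<c _ _ = CycleFromMin-descent ys low b<c
  ...   | tri≈ _ b≡c _ with simple low
  ...     | _ ∷ (c∉ ∷ _) = All.lookup c∉ (∈-++⁺ʳ ys (here refl)) (sym b≡c)
  CycleFromMin-impossible {xs = c ∷ xs} low len | ys ∷ʳ′ b | tri> _ _ c<b =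
    CycleFromMin-descent (reverse ys) (subst (CycleFromMin CycleStep _) reverse≡ (CycleFromMin-reverse CycleStep-sym low)) c<b
    where
    reverse≡ : reverse (c ∷ ys ++ [ b ]) ≡ b ∷ reverse ys ++ [ c ]
    reverse≡ = trans (reverse-++ (c ∷ ys) [ b ]) (cong (b ∷_) (unfold-reverse c ys))

  noBrokenCircuit : ⊥
  noBrokenCircuit with CycleFromMin-rotate (start c) (rest c) cycle-closed (dist c)
  ... | _ , _ , low , length≡ = CycleFromMin-impossible low (s≤s⁻¹ (subst (3 ≤_) length≡ (long c)))

mainTheorem15 : ∀ (n : ℕ) (G : Graph n) → NoTriangle G →
    ∀ (k : ℕ) (S : List (Edge n)) → TightForest k G S → NBC k G S
mainTheorem15 n G noTriangle k S ((wf-S , S⊆G , _) , |S|≡k , tight) =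
  wf-S , S⊆G , |S|≡k , noBrokenCircuit G noTriangle S tight
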